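{- The Farey graph is not a minor of $T_{\aleph_0} * t$.
   Context: $H$ is a minor of $G$ if there are disjoint non-empty vertex sets $V_h\subseteq V(G)$ ($h\in V(H)$), each inducing a connected subgraph, with a $V_h$–$V_{h'}$ edge in $G$ whenever $hh'\in E(H)$. The Farey graph is the graph on $\mathbb{Q}\cup\{\infty\}$ in which $a/b$ and $c/d$ in lowest terms (with $\infty=(\pm1)/0$) are adjacent iff $ad-bc=\pm1$. $T_{\aleph_0}$ is the tree in which every vertex has countably infinite degree, and $T_{\aleph_0}*t$ is obtained from it by adding a new vertex $t$ adjacent to all its vertices. -}

module Defs where

open import Data.Nat using (ℕ)
open import Data.Integer using (ℤ; +_; _*_; _-_; ∣_∣)
open import Data.Rational using (ℚ; ↥_; ↧_)
open import Data.List using (List; _∷_)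
open import Data.Maybe using (Maybe; just; nothing)
open import Data.Sum using (_⊎_; inj₁; inj₂)
open import Data.Unit using (⊤; tt)
open import Data.Empty using (⊥)
open import Data.Product using (Σ; ∃; _×_; _,_)
open import Relation.Binary.PropositionalEquality using (_≡_)

record Graph : Set₁ where
  field
    V : Set
    E : V → V → Set

open Graph public

data WalkIn (G : Graph) (P : V G → Set) : V G → V G → Set where
  here : ∀ {u} → P u → WalkIn G P u u
  step : ∀ {u v w} → P u → E G u v → WalkIn G P v w → WalkIn G P u w

InducesConnected : (G : Graph) → (V G → Set) → Set
InducesConnected G P = ∀ u v → P u → P v → WalkIn G P u v

record MinorModel (H G : Graph) : Set₁ where
  field
    branch    : V H → V G → Set
    nonempty  : ∀ h → ∃ λ v → branch h v
    disjoint  : ∀ h h' v → branch h v → branch h' v → h ≡ h'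
    connected : ∀ h → InducesConnected G (branch h)
    edges     : ∀ h h' → E H h h' → Σ (V G) λ u → Σ (V G) λ v →
                  branch h u × branch h' v × E G u v

IsMinor : Graph → Graph → Set₁
IsMinor H G = MinorModel H G

-- Farey graph: vertices ℚ ∪ {∞}; ∞ is represented by inj₂ tt with fraction 1/0.
-- Rationals in Data.Rational are stored in lowest terms with positive denominator.
numer : ℚ ⊎ ⊤ → ℤ
numer (inj₁ q) = ↥ q
numer (inj₂ _) = + 1

denom : ℚ ⊎ ⊤ → ℤ
denom (inj₁ q) = ↧ q
denom (inj₂ _) = + 0

Farey : Graph
Farey = record
  { V = ℚ ⊎ ⊤
  ; E = λ x y → ∣ numer x * denom y - denom x * numer y ∣ ≡ 1
  }

-- Concrete model: vertices are finite sequences of naturals, s adjacent to n ∷ s.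
-- (The root [] has children n ∷ [] for all n; other vertices have ℵ₀ children plus a parent.)
TreeAdj : List ℕ → List ℕ → Set
TreeAdj s t = (∃ λ n → t ≡ n ∷ s) ⊎ (∃ λ n → s ≡ n ∷ t)

Tℵ₀ : Graph
Tℵ₀ = record { V = List ℕ ; E = TreeAdj }

ConeAdj : Maybe (List ℕ) → Maybe (List ℕ) → Set
ConeAdj nothing  nothing  = ⊥
ConeAdj nothing  (just _) = ⊤
ConeAdj (just _) nothing  = ⊤
ConeAdj (just s) (just u) = TreeAdj s u

Tℵ₀*t : Graph
Tℵ₀*t = record { V = Maybe (List ℕ) ; E = ConeAdj }

-- A triangle can only be a minor of a tree through the apex t: if three pairwise adjacent
-- branch sets avoid t, each lies in a subtree, and along every edge one of them hangs below
-- the other (its topmost vertex is a child of a vertex of the other). A branch set hangs below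
-- at most one other, so the three edges form a cycle of hangings, and the depths of the
-- attachment vertices would strictly increase around it. As t lies in only one branch set,
-- a graph with two vertex-disjoint triangles, such as the Farey graph with {0, 1, ∞} and
-- {2, 3, 5/2}, is not a minor of T_ℵ₀ * t.
module Submission where

open import Defs
open import Data.Nat using (ℕ; _<_)
open import Data.Nat.Properties using (<-irrefl; <-trans; m≤n+m)
open import Data.List using (List; []; _∷_; _++_; length)
open import Data.List.Properties using (length-++; ++-assoc; ++-identityˡ-unique; ++-conicalˡ; ∷-injective)
open import Data.List.Relation.Unary.All as All using (All; []; _∷_)
open import Data.Maybe using (just; nothing)
open import Data.Maybe.Properties using (just-injective)
open import Data.Rational using (_/_; 0ℚ; 1ℚ)
open import Data.Integer using (+_)
open import Data.Sum using (_⊎_; inj₁; inj₂)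
open import Data.Unit using (tt)
open import Data.Empty using (⊥; ⊥-elim)
open import Data.Product using (∃; _,_)
open import Relation.Nullary using (¬_)
open import Relation.Binary.PropositionalEquality using (_≡_; _≢_; refl; sym; cong; subst; module ≡-Reasoning)

walk-source : ∀ {G : Graph} {P : V G → Set} {u v} → WalkIn G P u v → P u
walk-source (here p)     = p
walk-source (step p _ _) = p

record Triangle (H : Graph) : Set where
  field
    a b c    : V H
    a≢b      : a ≢ b
    b≢c      : b ≢ c
    c≢a      : c ≢ a
    ab       : E H a b
    bc       : E H b c
    ca       : E H c a

  corners : List (V H)
  corners = a ∷ b ∷ c ∷ []

open Triangle

VertexDisjoint : ∀ {H} → Triangle H → Triangle H → Set
VertexDisjoint T U = All (λ x → All (x ≢_) (corners U)) (corners T)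

suffix-antisym : ∀ {A : Set} {xs ys : List A} (p q : List A) →
                 xs ≡ p ++ ys → ys ≡ q ++ xs → xs ≡ ys
suffix-antisym {xs = xs} {ys} p q xs≡pys ys≡qxs = subst (λ r → xs ≡ r ++ ys) p≡[] xs≡pys
  where
  open ≡-Reasoning
  xs≡pqxs : xs ≡ (p ++ q) ++ xs
  xs≡pqxs = begin
    xs             ≡⟨ xs≡pys ⟩
    p ++ ys        ≡⟨ cong (p ++_) ys≡qxs ⟩
    p ++ (q ++ xs) ≡⟨ ++-assoc p q xs ⟨
    (p ++ q) ++ xs ∎
  p≡[] : p ≡ []
  p≡[] = ++-conicalˡ p q (++-identityˡ-unique (p ++ q) xs≡pqxs)

length-suffix-< : ∀ {A : Set} (p : List A) (x : A) (s : List A) → length s < length (p ++ x ∷ s)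
length-suffix-< p x s rewrite length-++ p {x ∷ s} = m≤n+m (length (x ∷ s)) (length p)

DescendsFrom : List ℕ → V Tℵ₀*t → Set
DescendsFrom s w = ∃ λ p → w ≡ just (p ++ s)

walk-stays-in-subtree : ∀ {P : V Tℵ₀*t → Set} {n s w w′} → ¬ P nothing → ¬ P (just s) →
                        DescendsFrom (n ∷ s) w → WalkIn Tℵ₀*t P w w′ → DescendsFrom (n ∷ s) w′
walk-stays-in-subtree ¬apex ¬parent below (here _) = below
walk-stays-in-subtree ¬apex ¬parent (p , refl) (step {v = nothing} _ _ walk) =
  ⊥-elim (¬apex (walk-source walk))
walk-stays-in-subtree ¬apex ¬parent (p , refl) (step {v = just _} _ (inj₁ (m , refl)) walk) =
  walk-stays-in-subtree ¬apex ¬parent (m ∷ p , refl) walk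
walk-stays-in-subtree ¬apex ¬parent ([] , refl) (step {v = just _} _ (inj₂ (_ , refl)) walk) =
  ⊥-elim (¬parent (walk-source walk))
walk-stays-in-subtree ¬apex ¬parent (_ ∷ p , refl) (step {v = just _} _ (inj₂ (_ , refl)) walk) =
  walk-stays-in-subtree ¬apex ¬parent (p , refl) walk

module _ {H : Graph} (M : MinorModel H Tℵ₀*t) where
  open MinorModel M

  ApexFree : V H → Set
  ApexFree h = ¬ branch h nothing

  record HangsBelow (h k : V H) : Set where
    field
      parent    : List ℕ
      parent∈k  : branch k (just parent)
      label     : ℕ
      root∈h    : branch h (just (label ∷ parent))
      h-subtree : ∀ w → branch h w → DescendsFrom (label ∷ parent) w

  open HangsBelow

  hangs-below : ∀ {h k s n} → h ≢ k → ApexFree h →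
                branch k (just s) → branch h (just (n ∷ s)) → HangsBelow h k
  hangs-below {h} {k} {s} {n} h≢k ¬apex s∈k ns∈h = record
    { parent    = s
    ; parent∈k  = s∈k
    ; label     = n
    ; root∈h    = ns∈h
    ; h-subtree = λ w w∈h →
        walk-stays-in-subtree ¬apex (λ s∈h → h≢k (disjoint h k (just s) s∈h s∈k))
          ([] , refl) (connected h _ w ns∈h w∈h)
    }

  edge-hangs : ∀ {h k} → h ≢ k → ApexFree h → ApexFree k → E H h k → HangsBelow h k ⊎ HangsBelow k h
  edge-hangs {h} {k} h≢k ¬apex-h ¬apex-k hk with edges h k hk
  ... | nothing , _ , apex∈h , _ , _                    = ⊥-elim (¬apex-h apex∈h)
  ... | just _ , nothing , _ , apex∈k , _               = ⊥-elim (¬apex-k apex∈k)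
  ... | just x , just _ , x∈h , nx∈k , inj₁ (_ , refl) = inj₂ (hangs-below (λ k≡h → h≢k (sym k≡h)) ¬apex-k x∈h nx∈k)
  ... | just _ , just y , ny∈h , y∈k , inj₂ (_ , refl) = inj₁ (hangs-below h≢k ¬apex-h y∈k ny∈h)

  parent-shorter : ∀ {h k x} (hk : HangsBelow h k) → branch h (just x) → length (parent hk) < length x
  parent-shorter hk x∈h with h-subtree hk _ x∈h
  ... | p , refl = length-suffix-< p (label hk) (parent hk)

  no-hanging-cycle : ∀ {h k l} → HangsBelow h k → HangsBelow k l → HangsBelow l h → ⊥
  no-hanging-cycle hk kl lh =
    <-irrefl refl (<-trans (parent-shorter lh (parent∈k kl))
                    (<-trans (parent-shorter kl (parent∈k hk)) (parent-shorter hk (parent∈k lh))))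

  hangs-below-unique : ∀ {h k l} → HangsBelow h k → HangsBelow h l → k ≡ l
  hangs-below-unique {k = k} {l} hk hl
    with h-subtree hl _ (root∈h hk) | h-subtree hk _ (root∈h hl)
  ... | p , root-k≡ | q , root-l≡
    with ∷-injective (suffix-antisym p q (just-injective root-k≡) (just-injective root-l≡))
  ... | _ , parents-equal =
    disjoint k l _ (parent∈k hk) (subst (λ s → branch l (just s)) (sym parents-equal) (parent∈k hl))

  triangle-meets-apex : (T : Triangle H) → ¬ All ApexFree (corners T)
  -- Either the three edges orient into a cycle, or some corner hangs below both of the others.
  triangle-meets-apex T (¬a ∷ ¬b ∷ ¬c ∷ [])
    with edge-hangs (a≢b T) ¬a ¬b (ab T) | edge-hangs (b≢c T) ¬b ¬c (bc T) | edge-hangs (c≢a T) ¬c ¬a (ca T)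
  ... | inj₁ a↓b | inj₁ b↓c | inj₁ c↓a = no-hanging-cycle a↓b b↓c c↓a
  ... | inj₂ b↓a | inj₂ c↓b | inj₂ a↓c = no-hanging-cycle a↓c c↓b b↓a
  ... | inj₁ a↓b | _        | inj₂ a↓c = b≢c T (hangs-below-unique a↓b a↓c)
  ... | inj₂ b↓a | inj₁ b↓c | _        = c≢a T (sym (hangs-below-unique b↓a b↓c))
  ... | _        | inj₂ c↓b | inj₁ c↓a = a≢b T (sym (hangs-below-unique c↓b c↓a))

disjoint-triangles-not-minor : ∀ {H} (T U : Triangle H) → VertexDisjoint T U → ¬ MinorModel H Tℵ₀*t
disjoint-triangles-not-minor T U T∩U=∅ M = triangle-meets-apex M T (All.map apex-not-in T∩U=∅)
  where
  open MinorModel M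
  apex-not-in : ∀ {x} → All (x ≢_) (corners U) → ApexFree M x
  apex-not-in x∉U apex∈x =
    triangle-meets-apex M U (All.map (λ x≢y apex∈y → x≢y (disjoint _ _ nothing apex∈x apex∈y)) x∉U)

farey-0-1-∞ : Triangle Farey
farey-0-1-∞ = record
  { a = inj₁ 0ℚ ; b = inj₁ 1ℚ ; c = inj₂ tt
  ; a≢b = λ () ; b≢c = λ () ; c≢a = λ ()
  ; ab = refl ; bc = refl ; ca = refl
  }

farey-2-3-5/2 : Triangle Farey
farey-2-3-5/2 = record
  { a = inj₁ (+ 2 / 1) ; b = inj₁ (+ 3 / 1) ; c = inj₁ (+ 5 / 2)
  ; a≢b = λ () ; b≢c = λ () ; c≢a = λ ()
  ; ab = refl ; bc = refl ; ca = refl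
  }

farey-triangles-disjoint : VertexDisjoint farey-0-1-∞ farey-2-3-5/2
farey-triangles-disjoint =
  ((λ ()) ∷ (λ ()) ∷ (λ ()) ∷ []) ∷
  ((λ ()) ∷ (λ ()) ∷ (λ ()) ∷ []) ∷
  ((λ ()) ∷ (λ ()) ∷ (λ ()) ∷ []) ∷ []

lemma3p1 : ¬ IsMinor Farey Tℵ₀*t
lemma3p1 = disjoint-triangles-not-minor farey-0-1-∞ farey-2-3-5/2 farey-triangles-disjoint
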